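{- Let $G$ be a finite simple graph with $n$ vertices and $e$ edges, where $0<e<n(n-1)/2$, and let $\overline{G}$ be its complement. Then for every positive integer $m$: $m\in M(G)$ if and only if $\dfrac{m\big(n(n-1)/2-e\big)}{e}\in M(\overline{G})$.
   Context: For a positive integer $m$, $mK_n$ denotes the $m$-fold complete multigraph on $n$ vertices, with exactly $m$ parallel edges between each pair of distinct vertices. For a graph $G$ on $n$ vertices, $mK_n$ "can be partitioned into copies of $G$" if there is a finite list of graphs $G_1,\dots,G_l$, each on the same $n$-element vertex set and each isomorphic to $G$, such that every pair of distinct vertices is an edge of exactly $m$ of the $G_i$. Define $M(G)=\{m\in\mathbb{Z}_{>0} : mK_n \text{ can be partitioned into copies of } G\}$ (in particular it contains only positive integers). -}

module Defs where

open import Data.Nat using (ℕ; zero; suc; _+_; _*_; _∸_; _<_)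
open import Data.Nat.DivMod using (_/_)
open import Data.Bool using (Bool; true; false; not; _∧_; if_then_else_)
open import Data.Fin using (Fin; toℕ)
open import Data.Fin.Permutation using (Permutation′; _⟨$⟩ʳ_)
open import Data.List using (List; []; _∷_; map; allFin)
open import Data.Nat.ListAction using (sum)
open import Data.Product using (Σ; _×_; ∃)
open import Relation.Binary.PropositionalEquality using (_≡_; _≢_)
open import Relation.Nullary.Decidable using (⌊_⌋)
open import Data.Nat using (_<ᵇ_)

record SimpleGraph (n : ℕ) : Set where
  field
    adj   : Fin n → Fin n → Bool
    adj-sym : ∀ i j → adj i j ≡ adj j i
    adj-irrefl : ∀ i → adj i i ≡ false
open SimpleGraph public

complement : ∀ {n} → SimpleGraph n → SimpleGraph n
complement {n} G = record
  { adj = λ i j → if ⌊ i Data.Fin.≟ j ⌋ then false else not (adj G i j)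
  ; adj-sym = symC
  ; adj-irrefl = irrC
  }
  where
  open import Data.Fin.Properties using () renaming (_≟_ to _≟F_)
  open import Relation.Nullary using (yes; no)
  open import Relation.Binary.PropositionalEquality using (refl; sym; cong)
  symC : ∀ i j → (if ⌊ i Data.Fin.≟ j ⌋ then false else not (adj G i j))
               ≡ (if ⌊ j Data.Fin.≟ i ⌋ then false else not (adj G j i))
  symC i j with i Data.Fin.≟ j | j Data.Fin.≟ i
  ... | yes _ | yes _ = refl
  ... | yes p | no q = Data.Empty.⊥-elim (q (sym p)) where import Data.Empty
  ... | no p | yes q = Data.Empty.⊥-elim (p (sym q)) where import Data.Empty
  ... | no _ | no _ = cong not (adj-sym G i j)
  irrC : ∀ i → (if ⌊ i Data.Fin.≟ i ⌋ then false else not (adj G i i)) ≡ false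
  irrC i with i Data.Fin.≟ i
  ... | yes _ = refl
  ... | no p = Data.Empty.⊥-elim (p refl) where import Data.Empty

_≅_ : ∀ {n} → SimpleGraph n → SimpleGraph n → Set
_≅_ {n} H G = Σ (Permutation′ n) λ π →
  ∀ i j → adj H i j ≡ adj G (π ⟨$⟩ʳ i) (π ⟨$⟩ʳ j)

Copy : ∀ {n} → SimpleGraph n → Set
Copy {n} G = Σ (SimpleGraph n) λ H → H ≅ G

copyAdj : ∀ {n} {G : SimpleGraph n} → Copy G → Fin n → Fin n → Bool
copyAdj (H Data.Product., _) = adj H

countTrue : List Bool → ℕ
countTrue [] = 0
countTrue (true ∷ bs) = suc (countTrue bs)
countTrue (false ∷ bs) = countTrue bs

-- mK_n can be partitioned into copies of G: a finite list of copies of G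
-- such that every pair of distinct vertices is an edge of exactly m of them.
Partitionable : ∀ {n} → ℕ → SimpleGraph n → Set
Partitionable {n} m G = Σ (List (Copy G)) λ cs →
  ∀ (i j : Fin n) → i ≢ j → countTrue (map (λ c → copyAdj {G = G} c i j) cs) ≡ m

InM : ∀ {n} → SimpleGraph n → ℕ → Set
InM G m = (0 < m) × Partitionable m G

numEdges : ∀ {n} → SimpleGraph n → ℕ
numEdges {n} G = sum (map (λ i → countTrue (map (λ j → (toℕ i <ᵇ toℕ j) ∧ adj G i j) (allFin n))) (allFin n))

pairs : ℕ → ℕ
pairs n = n * (n ∸ 1) / 2

-- Take a family of copies of G covering every pair of vertices exactly m
-- times, say l of them. Counting edges with multiplicity gives l e = m P,
-- where P = n(n-1)/2, and the complements of the copies are copies of the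
-- complement covering every pair exactly l - m times. Since the complement
-- has P - e edges, l e = m P is equivalent to (l - m) e = m (P - e), so
-- k = l - m is the predicted multiplicity. Applying the same construction
-- to the complement, whose complement is G again, gives the converse.
--
-- Copies of G have e edges because numEdges, a sum over pairs i < j, is half
-- the sum of the whole adjacency matrix, which a permutation of the vertices
-- only rearranges.
module Submission where

open import Defs
open import Data.Nat using (ℕ; _<_; _*_; _∸_)
open import Data.Product using (Σ; _×_)
open import Function.Bundles using (_⇔_)
open import Relation.Binary.PropositionalEquality using (_≡_)

open import Data.Nat using (zero; suc; _+_; _<ᵇ_; >-nonZero)
open import Data.Nat.Properties
  using ( +-comm; +-suc; +-identityʳ; *-comm; *-identityʳ; *-distribˡ-+; *-distribʳ-+
        ; *-distribʳ-∸; m+n∸n≡m; m+n∸m≡n; m<n⇒0<n∸m; *-mono-<; *-cancelʳ-<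
        ; *-cancelˡ-≡; *-cancelʳ-≡; +-*-semiring; *-commutativeSemigroup )
open import Data.Nat.DivMod using (_/_; m*n/n≡m)
open import Data.Nat.ListAction using (sum)
open import Data.Bool using (Bool; true; false; not; _∧_)
open import Data.Bool.Properties using (not-involutive)
open import Data.Fin using (Fin; zero; suc; toℕ; _≟_)
open import Data.Fin.Properties using (toℕ-injective)
open import Data.Fin.Permutation using (Permutation′; _⟨$⟩ʳ_; _⟨$⟩ˡ_; inverseˡ)
open import Data.List using (List; []; _∷_; map; tabulate; length; allFin)
open import Data.List.Properties using (map-∘; map-cong; length-map)
open import Data.Product using (_,_; proj₁)
open import Data.Empty using (⊥-elim)
open import Function.Base using (_∘_; id)
open import Function.Bundles using (mk⇔)
open import Relation.Binary.PropositionalEquality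
  using (refl; sym; trans; cong; cong₂; subst; _≢_; module ≡-Reasoning)
open import Relation.Nullary using (yes; no)
open import Algebra.Properties.CommutativeSemigroup *-commutativeSemigroup
  using (x∙yz≈y∙xz)
open import Algebra.Properties.Semiring.Sum +-*-semiring
  using (sum-syntax; sum-cong-≗; ∑-distrib-+; ∑-comm; ∑-permute; *-distribˡ-sum)

private
  variable
    n : ℕ

𝟙 : Bool → ℕ
𝟙 true  = 1
𝟙 false = 0

𝟙-∧ : ∀ a b → 𝟙 (a ∧ b) ≡ 𝟙 a * 𝟙 b
𝟙-∧ true  b = sym (+-identityʳ (𝟙 b))
𝟙-∧ false b = refl

𝟙-not : ∀ b → 𝟙 b + 𝟙 (not b) ≡ 1
𝟙-not true  = refl
𝟙-not false = refl

𝟙-<ᵇ-flip : ∀ {a b} → a ≢ b → 𝟙 (a <ᵇ b) + 𝟙 (b <ᵇ a) ≡ 1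
𝟙-<ᵇ-flip {zero}  {zero}  a≢b = ⊥-elim (a≢b refl)
𝟙-<ᵇ-flip {zero}  {suc b} _   = refl
𝟙-<ᵇ-flip {suc a} {zero}  _   = refl
𝟙-<ᵇ-flip {suc a} {suc b} a≢b = 𝟙-<ᵇ-flip (a≢b ∘ cong suc)

countTrue-tabulate : ∀ {A : Set} (f : Fin n → A) (p : A → Bool) →
  countTrue (map p (tabulate f)) ≡ ∑[ i < n ] 𝟙 (p (f i))
countTrue-tabulate {zero}  f p = refl
countTrue-tabulate {suc n} f p with p (f zero)
... | true  = cong suc (countTrue-tabulate (f ∘ suc) p)
... | false = countTrue-tabulate (f ∘ suc) p

sum-tabulate : ∀ {A : Set} (f : Fin n → A) (g : A → ℕ) →
  sum (map g (tabulate f)) ≡ ∑[ i < n ] g (f i)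
sum-tabulate {zero}  f g = refl
sum-tabulate {suc n} f g = cong (g (f zero) +_) (sum-tabulate (f ∘ suc) g)

∑-ones : ∀ n → ∑[ i < n ] 1 ≡ n
∑-ones zero    = refl
∑-ones (suc n) = cong suc (∑-ones n)

𝟙< : Fin n → Fin n → ℕ
𝟙< i j = 𝟙 (toℕ i <ᵇ toℕ j)

totalSum : (Fin n → Fin n → ℕ) → ℕ
totalSum {n} f = ∑[ i < n ] ∑[ j < n ] f i j

upperSum : (Fin n → Fin n → ℕ) → ℕ
upperSum {n} f = ∑[ i < n ] ∑[ j < n ] (𝟙< i j * f i j)

𝟙<-irrefl : (i : Fin n) → 𝟙< i i ≡ 0
𝟙<-irrefl i = cong 𝟙 (<ᵇ-irrefl (toℕ i))
  where
  <ᵇ-irrefl : ∀ a → (a <ᵇ a) ≡ false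
  <ᵇ-irrefl zero    = refl
  <ᵇ-irrefl (suc a) = <ᵇ-irrefl a

𝟙<-flip : {i j : Fin n} → i ≢ j → 𝟙< i j + 𝟙< j i ≡ 1
𝟙<-flip i≢j = 𝟙-<ᵇ-flip (i≢j ∘ toℕ-injective)

upperSum-cong : {f g : Fin n → Fin n → ℕ} →
  (∀ i j → i ≢ j → f i j ≡ g i j) → upperSum f ≡ upperSum g
upperSum-cong {f = f} {g} f≡g = sum-cong-≗ λ i → sum-cong-≗ λ j → weighted i j
  where
  weighted : ∀ i j → 𝟙< i j * f i j ≡ 𝟙< i j * g i j
  weighted i j with i ≟ j
  weighted i .i | yes refl rewrite 𝟙<-irrefl i = refl
  ... | no i≢j   = cong (𝟙< i j *_) (f≡g i j i≢j)

upperSum-+ : (f g : Fin n → Fin n → ℕ) →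
  upperSum (λ i j → f i j + g i j) ≡ upperSum f + upperSum g
upperSum-+ {n} f g = trans
  (sum-cong-≗ λ i → trans (sum-cong-≗ λ j → *-distribˡ-+ (𝟙< i j) (f i j) (g i j))
                          (∑-distrib-+ (λ j → 𝟙< i j * f i j) (λ j → 𝟙< i j * g i j)))
  (∑-distrib-+ (λ i → ∑[ j < n ] (𝟙< i j * f i j)) (λ i → ∑[ j < n ] (𝟙< i j * g i j)))

upperSum-* : (r : ℕ) (f : Fin n → Fin n → ℕ) →
  upperSum (λ i j → r * f i j) ≡ r * upperSum f
upperSum-* {n} r f = sym (trans
  (*-distribˡ-sum r (λ i → ∑[ j < n ] (𝟙< i j * f i j)))
  (sum-cong-≗ λ i → trans (*-distribˡ-sum r (λ j → 𝟙< i j * f i j))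
                          (sum-cong-≗ λ j → x∙yz≈y∙xz r (𝟙< i j) (f i j))))

totalSum≡2*upperSum : (f : Fin n → Fin n → ℕ) →
  (∀ i → f i i ≡ 0) → (∀ i j → f i j ≡ f j i) →
  totalSum f ≡ 2 * upperSum f
totalSum≡2*upperSum {n} f diagonal symmetric = begin
  totalSum f
    ≡⟨ sum-cong-≗ (λ i → sum-cong-≗ λ j → split i j) ⟩
  ∑[ i < n ] ∑[ j < n ] (upper i j + lower i j)
    ≡⟨ sum-cong-≗ (λ i → ∑-distrib-+ (upper i) (lower i)) ⟩
  ∑[ i < n ] (∑[ j < n ] upper i j + ∑[ j < n ] lower i j)
    ≡⟨ ∑-distrib-+ (λ i → ∑[ j < n ] upper i j) (λ i → ∑[ j < n ] lower i j) ⟩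
  upperSum f + ∑[ i < n ] ∑[ j < n ] lower i j
    ≡⟨ cong (upperSum f +_) (∑-comm lower) ⟩
  upperSum f + ∑[ j < n ] ∑[ i < n ] lower i j
    ≡⟨ cong (upperSum f +_) (sum-cong-≗ λ j → sum-cong-≗ λ i →
                                cong (𝟙< j i *_) (symmetric i j)) ⟩
  upperSum f + upperSum f
    ≡⟨ cong (upperSum f +_) (+-identityʳ (upperSum f)) ⟨
  2 * upperSum f ∎
  where
  open ≡-Reasoning
  upper lower : Fin n → Fin n → ℕ
  upper i j = 𝟙< i j * f i j
  lower i j = 𝟙< j i * f i j
  split : ∀ i j → f i j ≡ upper i j + lower i j
  split i j with i ≟ j
  split i .i | yes refl rewrite diagonal i | 𝟙<-irrefl i = refl
  split i j  | no i≢j = begin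
    f i j                             ≡⟨ +-identityʳ (f i j) ⟨
    1 * f i j                         ≡⟨ cong (_* f i j) (𝟙<-flip i≢j) ⟨
    (𝟙< i j + 𝟙< j i) * f i j         ≡⟨ *-distribʳ-+ (f i j) (𝟙< i j) (𝟙< j i) ⟩
    𝟙< i j * f i j + 𝟙< j i * f i j   ∎

totalSum-permute : (f : Fin n → Fin n → ℕ) (π : Permutation′ n) →
  totalSum (λ i j → f (π ⟨$⟩ʳ i) (π ⟨$⟩ʳ j)) ≡ totalSum f
totalSum-permute f π = sym (trans
  (∑-permute (λ i → ∑[ j < _ ] f i j) π)
  (sum-cong-≗ λ i → ∑-permute (f (π ⟨$⟩ʳ i)) π))

upperSum-ones-suc : ∀ n → upperSum {suc n} (λ _ _ → 1) ≡ n + upperSum {n} (λ _ _ → 1)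
-- Row 0 contributes n ones and rows suc i are the rows i of Fin n, definitionally.
upperSum-ones-suc n = cong (_+ upperSum {n} (λ _ _ → 1)) (∑-ones n)

upperSum-ones*2 : ∀ n → upperSum {n} (λ _ _ → 1) * 2 ≡ n * (n ∸ 1)
upperSum-ones*2 zero = refl
upperSum-ones*2 (suc n) = begin
  upperSum {suc n} (λ _ _ → 1) * 2  ≡⟨ cong (_* 2) (upperSum-ones-suc n) ⟩
  (n + u) * 2                       ≡⟨ *-distribʳ-+ 2 n u ⟩
  n * 2 + u * 2                     ≡⟨ cong (n * 2 +_) (upperSum-ones*2 n) ⟩
  n * 2 + n * (n ∸ 1)               ≡⟨ n*2+n*[n∸1]≡[1+n]*n n ⟩
  suc n * n                         ∎
  where
  open ≡-Reasoning
  u : ℕ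
  u = upperSum {n} (λ _ _ → 1)
  n*2+n*[n∸1]≡[1+n]*n : ∀ n → n * 2 + n * (n ∸ 1) ≡ suc n * n
  n*2+n*[n∸1]≡[1+n]*n zero    = refl
  n*2+n*[n∸1]≡[1+n]*n (suc n) =
    trans (sym (*-distribˡ-+ (suc n) 2 n)) (*-comm (suc n) (suc (suc n)))

pairs≡upperSum-ones : ∀ n → pairs n ≡ upperSum {n} (λ _ _ → 1)
pairs≡upperSum-ones n =
  trans (cong (_/ 2) (sym (upperSum-ones*2 n))) (m*n/n≡m (upperSum {n} (λ _ _ → 1)) 2)

adjacency : SimpleGraph n → Fin n → Fin n → ℕ
adjacency H i j = 𝟙 (adj H i j)

numEdges≡upperSum : (H : SimpleGraph n) → numEdges H ≡ upperSum (adjacency H)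
numEdges≡upperSum {n} H = trans (sum-tabulate id row) (sum-cong-≗ λ i →
  trans (countTrue-tabulate id (λ j → (toℕ i <ᵇ toℕ j) ∧ adj H i j))
        (sum-cong-≗ λ j → 𝟙-∧ (toℕ i <ᵇ toℕ j) (adj H i j)))
  where
  row : Fin n → ℕ
  row i = countTrue (map (λ j → (toℕ i <ᵇ toℕ j) ∧ adj H i j) (allFin n))

totalSum-adjacency : (H : SimpleGraph n) → totalSum (adjacency H) ≡ 2 * numEdges H
totalSum-adjacency H = trans
  (totalSum≡2*upperSum (adjacency H) (cong 𝟙 ∘ adj-irrefl H) (λ i j → cong 𝟙 (adj-sym H i j)))
  (cong (2 *_) (sym (numEdges≡upperSum H)))

numEdges-≅ : {H G : SimpleGraph n} → H ≅ G → numEdges H ≡ numEdges G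
numEdges-≅ {H = H} {G} (π , H≅G) = *-cancelˡ-≡ (numEdges H) (numEdges G) 2 (begin
  2 * numEdges H
    ≡⟨ totalSum-adjacency H ⟨
  totalSum (adjacency H)
    ≡⟨ sum-cong-≗ (λ i → sum-cong-≗ λ j → cong 𝟙 (H≅G i j)) ⟩
  totalSum (λ i j → adjacency G (π ⟨$⟩ʳ i) (π ⟨$⟩ʳ j))
    ≡⟨ totalSum-permute (adjacency G) π ⟩
  totalSum (adjacency G)
    ≡⟨ totalSum-adjacency G ⟩
  2 * numEdges G ∎)
  where open ≡-Reasoning

adj-complement : (G : SimpleGraph n) {i j : Fin n} → i ≢ j →
  adj (complement G) i j ≡ not (adj G i j)
adj-complement G {i} {j} i≢j with i ≟ j
... | yes i≡j = ⊥-elim (i≢j i≡j)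
... | no _    = refl

adj-complement-complement : (G : SimpleGraph n) (i j : Fin n) →
  adj (complement (complement G)) i j ≡ adj G i j
adj-complement-complement G i j with i ≟ j
adj-complement-complement G i .i | yes refl = sym (adj-irrefl G i)
adj-complement-complement G i j  | no _     = not-involutive (adj G i j)

numEdges-complement : (G : SimpleGraph n) → numEdges G + numEdges (complement G) ≡ pairs n
numEdges-complement {n} G = begin
  numEdges G + numEdges Gᶜ
    ≡⟨ cong₂ _+_ (numEdges≡upperSum G) (numEdges≡upperSum Gᶜ) ⟩
  upperSum (adjacency G) + upperSum (adjacency Gᶜ)
    ≡⟨ upperSum-+ (adjacency G) (adjacency Gᶜ) ⟨
  upperSum (λ i j → adjacency G i j + adjacency Gᶜ i j)
    ≡⟨ upperSum-cong (λ i j i≢j → trans (cong (λ b → 𝟙 (adj G i j) + 𝟙 b) (adj-complement G i≢j))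
                                        (𝟙-not (adj G i j))) ⟩
  upperSum {n} (λ _ _ → 1)
    ≡⟨ pairs≡upperSum-ones n ⟨
  pairs n ∎
  where
  open ≡-Reasoning
  Gᶜ : SimpleGraph n
  Gᶜ = complement G

multiplicity : List (SimpleGraph n) → Fin n → Fin n → ℕ
multiplicity Hs i j = countTrue (map (λ H → adj H i j) Hs)

Covers : ℕ → List (SimpleGraph n) → Set
Covers {n} r Hs = (i j : Fin n) → i ≢ j → multiplicity Hs i j ≡ r

multiplicity-∷ : (H : SimpleGraph n) (Hs : List (SimpleGraph n)) (i j : Fin n) →
  multiplicity (H ∷ Hs) i j ≡ adjacency H i j + multiplicity Hs i j
multiplicity-∷ H Hs i j with adj H i j
... | true  = refl
... | false = refl

upperSum-multiplicity : (Hs : List (SimpleGraph n)) →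
  upperSum (multiplicity Hs) ≡ sum (map numEdges Hs)
-- At r = 0 both sides of upperSum-* reduce to those of upperSum (λ _ _ → 0) ≡ 0.
upperSum-multiplicity {n} []       = upperSum-* {n} 0 (λ _ _ → 0)
upperSum-multiplicity (H ∷ Hs) = begin
  upperSum (multiplicity (H ∷ Hs))
    ≡⟨ upperSum-cong (λ i j _ → multiplicity-∷ H Hs i j) ⟩
  upperSum (λ i j → adjacency H i j + multiplicity Hs i j)
    ≡⟨ upperSum-+ (adjacency H) (multiplicity Hs) ⟩
  upperSum (adjacency H) + upperSum (multiplicity Hs)
    ≡⟨ cong₂ _+_ (numEdges≡upperSum H) (sym (upperSum-multiplicity Hs)) ⟨
  numEdges H + sum (map numEdges Hs) ∎
  where open ≡-Reasoning

Covers⇒sum-numEdges : {r : ℕ} (Hs : List (SimpleGraph n)) → Covers r Hs →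
  sum (map numEdges Hs) ≡ r * pairs n
Covers⇒sum-numEdges {n} {r} Hs cover = begin
  sum (map numEdges Hs)                 ≡⟨ upperSum-multiplicity Hs ⟨
  upperSum (multiplicity Hs)            ≡⟨ upperSum-cong (λ i j i≢j →
                                             trans (cover i j i≢j) (sym (*-identityʳ r))) ⟩
  upperSum {n} (λ _ _ → r * 1)          ≡⟨ upperSum-* {n} r (λ _ _ → 1) ⟩
  r * upperSum {n} (λ _ _ → 1)          ≡⟨ cong (r *_) (pairs≡upperSum-ones n) ⟨
  r * pairs n                           ∎
  where open ≡-Reasoning

multiplicity-complement : (Hs : List (SimpleGraph n)) {i j : Fin n} → i ≢ j →
  multiplicity (map complement Hs) i j + multiplicity Hs i j ≡ length Hs
multiplicity-complement []       i≢j = refl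
multiplicity-complement (H ∷ Hs) {i} {j} i≢j rewrite adj-complement H i≢j with adj H i j
... | true  = trans (+-suc _ _) (cong suc (multiplicity-complement Hs i≢j))
... | false = cong suc (multiplicity-complement Hs i≢j)

Covers-complement : {r : ℕ} (Hs : List (SimpleGraph n)) → Covers r Hs →
  Covers (length Hs ∸ r) (map complement Hs)
Covers-complement {r = r} Hs cover i j i≢j = begin
  c                             ≡⟨ m+n∸n≡m c r ⟨
  c + r ∸ r                     ≡⟨ cong (λ d → c + d ∸ r) (cover i j i≢j) ⟨
  c + multiplicity Hs i j ∸ r   ≡⟨ cong (_∸ r) (multiplicity-complement Hs i≢j) ⟩
  length Hs ∸ r                 ∎
  where
  open ≡-Reasoning
  c : ℕ
  c = multiplicity (map complement Hs) i j

Partitionable⇒Covers : {r : ℕ} {G : SimpleGraph n} ((cs , _) : Partitionable r G) →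
  Covers r (map proj₁ cs)
Partitionable⇒Covers (cs , partition) i j i≢j =
  trans (sym (cong countTrue (map-∘ {g = λ H → adj H i j} {f = proj₁} cs))) (partition i j i≢j)

Covers⇒Partitionable : {r : ℕ} {G : SimpleGraph n} (cs : List (Copy G)) →
  Covers r (map proj₁ cs) → Partitionable r G
Covers⇒Partitionable cs cover =
  cs , λ i j i≢j →
    trans (cong countTrue (map-∘ {g = λ H → adj H i j} {f = proj₁} cs)) (cover i j i≢j)

sum-numEdges-copies : {G : SimpleGraph n} (cs : List (Copy G)) →
  sum (map numEdges (map proj₁ cs)) ≡ length cs * numEdges G
sum-numEdges-copies []              = refl
sum-numEdges-copies {G = G} ((H , H≅G) ∷ cs) =
  cong₂ _+_ (numEdges-≅ {H = H} {G} H≅G) (sum-numEdges-copies {G = G} cs)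

Partitionable-count : {r : ℕ} {G : SimpleGraph n} ((cs , _) : Partitionable r G) →
  length cs * numEdges G ≡ r * pairs n
Partitionable-count {G = G} p@(cs , _) = trans
  (sym (sum-numEdges-copies {G = G} cs))
  (Covers⇒sum-numEdges (map proj₁ cs) (Partitionable⇒Covers {G = G} p))

≅-respʳ : {H G G′ : SimpleGraph n} → (∀ i j → adj G i j ≡ adj G′ i j) → H ≅ G → H ≅ G′
≅-respʳ G≡G′ (π , H≅G) = π , λ i j → trans (H≅G i j) (G≡G′ _ _)

complement-≅ : {H G : SimpleGraph n} → H ≅ G → complement H ≅ complement G
complement-≅ {H = H} {G} (π , H≅G) = π , complement-adj
  where
  π-injective : ∀ {i j} → π ⟨$⟩ʳ i ≡ π ⟨$⟩ʳ j → i ≡ j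
  π-injective {i} {j} πi≡πj = trans (sym (inverseˡ π)) (trans (cong (π ⟨$⟩ˡ_) πi≡πj) (inverseˡ π))
  complement-adj : ∀ i j → adj (complement H) i j ≡ adj (complement G) (π ⟨$⟩ʳ i) (π ⟨$⟩ʳ j)
  complement-adj i j with i ≟ j
  ... | yes refl = sym (adj-irrefl (complement G) (π ⟨$⟩ʳ i))
  ... | no i≢j   = trans (cong not (H≅G i j)) (sym (adj-complement G (i≢j ∘ π-injective)))

complementCopy : {G : SimpleGraph n} → Copy G → Copy (complement G)
complementCopy {G = G} (H , H≅G) = complement H , complement-≅ {H = H} {G} H≅G

uncomplementCopy : {G : SimpleGraph n} → Copy (complement G) → Copy G
uncomplementCopy {G = G} (H , H≅Gᶜ) =
  complement H , ≅-respʳ {H = complement H} {complement (complement G)} {G}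
                   (adj-complement-complement G) (complement-≅ {H = H} {complement G} H≅Gᶜ)

Partitionable-complement : {r : ℕ} {G G′ : SimpleGraph n} (f : Copy G → Copy G′) →
  (∀ c → proj₁ (f c) ≡ complement (proj₁ c)) →
  ((cs , _) : Partitionable r G) → Partitionable (length cs ∸ r) G′
Partitionable-complement {r = r} {G} {G′} f f-complement p@(cs , _) =
  Covers⇒Partitionable {G = G′} (map f cs)
    (subst (Covers (length cs ∸ r)) complements
      (subst (λ l → Covers (l ∸ r) (map complement (map proj₁ cs))) (length-map proj₁ cs)
        (Covers-complement (map proj₁ cs) (Partitionable⇒Covers {G = G} p))))
  where
  complements : map complement (map proj₁ cs) ≡ map proj₁ (map f cs)
  complements = trans (sym (map-∘ cs)) (trans (map-cong (sym ∘ f-complement) cs) (map-∘ cs))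

[m∸n]*o≡n*p : ∀ m n o p → m * o ≡ n * (o + p) → (m ∸ n) * o ≡ n * p
[m∸n]*o≡n*p m n o p m*o≡ = begin
  (m ∸ n) * o             ≡⟨ *-distribʳ-∸ o m n ⟩
  m * o ∸ n * o           ≡⟨ cong (_∸ n * o) m*o≡ ⟩
  n * (o + p) ∸ n * o     ≡⟨ cong (_∸ n * o) (*-distribˡ-+ n o p) ⟩
  n * o + n * p ∸ n * o   ≡⟨ m+n∸m≡n (n * o) (n * p) ⟩
  n * p                   ∎
  where open ≡-Reasoning

Partitionable-complement-count : {r : ℕ} {G G′ : SimpleGraph n} →
  numEdges G + numEdges G′ ≡ pairs n → ((cs , _) : Partitionable r G) →
  (length cs ∸ r) * numEdges G ≡ r * numEdges G′
Partitionable-complement-count {r = r} {G} {G′} e+e′≡P p@(cs , _) =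
  [m∸n]*o≡n*p (length cs) r (numEdges G) (numEdges G′)
    (trans (Partitionable-count {G = G} p) (cong (r *_) (sym e+e′≡P)))

proposition4 : (n : ℕ) (G : SimpleGraph n) →
    0 < numEdges G → numEdges G < pairs n →
    (m : ℕ) → 0 < m →
      InM G m ⇔ Σ ℕ (λ k → (k * numEdges G ≡ m * (pairs n ∸ numEdges G)) × InM (complement G) k)
proposition4 n G _ e<P m 0<m = mk⇔ forward backward
  where
  e ē : ℕ
  e = numEdges G
  ē = numEdges (complement G)
  e+ē≡P : e + ē ≡ pairs n
  e+ē≡P = numEdges-complement G
  ē≡P∸e : ē ≡ pairs n ∸ e
  ē≡P∸e = trans (sym (m+n∸m≡n e ē)) (cong (_∸ e) e+ē≡P)
  0<ē : 0 < ē
  0<ē = subst (0 <_) (sym ē≡P∸e) (m<n⇒0<n∸m e<P)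

  forward : InM G m → Σ ℕ (λ k → (k * e ≡ m * (pairs n ∸ e)) × InM (complement G) k)
  forward (_ , p@(cs , _)) =
    length cs ∸ m , trans k*e≡m*ē (cong (m *_) ē≡P∸e) , 0<k ,
    Partitionable-complement {G = G} {complement G} (complementCopy {G = G}) (λ _ → refl) p
    where
    k*e≡m*ē : (length cs ∸ m) * e ≡ m * ē
    k*e≡m*ē = Partitionable-complement-count {G = G} {complement G} e+ē≡P p
    0<k : 0 < length cs ∸ m
    0<k = *-cancelʳ-< e 0 (length cs ∸ m) (subst (0 <_) (sym k*e≡m*ē) (*-mono-< 0<m 0<ē))

  backward : Σ ℕ (λ k → (k * e ≡ m * (pairs n ∸ e)) × InM (complement G) k) → InM G m
  backward (k , k*e≡ , _ , p@(ds , _)) = 0<m , subst (λ r → Partitionable r G) l∸k≡m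
    (Partitionable-complement {G = complement G} {G} (uncomplementCopy {G = G}) (λ _ → refl) p)
    where
    l∸k≡m : length ds ∸ k ≡ m
    l∸k≡m = *-cancelʳ-≡ (length ds ∸ k) m ē {{>-nonZero 0<ē}} (trans
      (Partitionable-complement-count {G = complement G} {G} (trans (+-comm ē e) e+ē≡P) p)
      (trans k*e≡ (cong (m *_) (sym ē≡P∸e))))
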